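{- For all $n\ge1$, $p(P_n;z)=u_{n+1}(1,z)$, and for all $n\ge3$, \[p(C_n;z)=\begin{cases} u_{n+1}(1,z)+z\,u_{n-1}(1,z) & n \text{ odd},\\ u_{n+1}(1,z)+z\,u_{n-1}(1,z)-z^{n/2} & n\text{ even}.\end{cases}\]
   Context: $P_n$ is the path on $n$ vertices and $C_n$ the cycle on $n$ vertices. The polynomials $u_n(x,y)$ are defined by $u_0=0$, $u_1=1$, $u_n(x,y)=x\,u_{n-1}(x,y)+y\,u_{n-2}(x,y)$ for $n\ge2$. A perfectly matchable set of a graph $G$ is a subset $S\subseteq V(G)$ such that $G[S]$ has a perfect matching (the empty set included); $p(G;z)=\sum_{k\ge0}p_{2k}z^k$ where $p_{2k}$ is the number of perfectly matchable sets of size $2k$. -}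

module Defs where

open import Data.Nat using (ℕ; zero; suc; _+_; _*_)
open import Data.Integer using (ℤ; +_; _-_) renaming (_+_ to _+ℤ_)
open import Data.Fin using (Fin; toℕ)
open import Data.Fin.Subset using (Subset; _∈_; ∣_∣)
open import Data.List using (List; length)
open import Data.List.Membership.Propositional using () renaming (_∈_ to _∈ₗ_)
open import Data.List.Relation.Unary.Unique.Propositional using (Unique)
open import Data.Product using (Σ; ∃; _×_)
open import Data.Sum using (_⊎_)
open import Function.Bundles using (_⇔_)
open import Relation.Binary.PropositionalEquality using (_≡_; _≢_)
open import Relation.Nullary using (Dec; yes; no)
open import Data.Nat.Properties using (_≟_)

-- Polynomials in z with integer coefficients, as coefficient sequences
-- (f k = coefficient of z^k).  Equality of polynomials = equality of
-- all coefficients.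

Poly : Set
Poly = ℕ → ℤ

_⊕_ : Poly → Poly → Poly
(f ⊕ g) k = f k +ℤ g k

_⊖_ : Poly → Poly → Poly
(f ⊖ g) k = f k - g k

z·_ : Poly → Poly
(z· f) zero    = + 0
(z· f) (suc k) = f k

zPow : ℕ → Poly
zPow m k with k ≟ m
... | yes _ = + 1
... | no  _ = + 0

-- u_n(1,z): the recurrence u_0 = 0, u_1 = 1, u_n = x u_{n-1} + y u_{n-2}
-- specialised at x = 1, y = z.
u : ℕ → Poly
u zero          k       = + 0
u (suc zero)    zero    = + 1
u (suc zero)    (suc k) = + 0
u (suc (suc n)) k       = (u (suc n) ⊕ (z· u n)) k

Graph : ℕ → Set₁
Graph n = Fin n → Fin n → Set

Path : (n : ℕ) → Graph n
Path n i j = (suc (toℕ i) ≡ toℕ j) ⊎ (suc (toℕ j) ≡ toℕ i)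

Cycle : (n : ℕ) → Graph n
Cycle n i j = Path n i j ⊎ ((toℕ i ≡ 0 × suc (toℕ j) ≡ n) ⊎ (toℕ j ≡ 0 × suc (toℕ i) ≡ n))

-- G[S] has a perfect matching: there is a partner map m on S that is a
-- fixed-point-free involution of S pairing each vertex with a neighbour
-- (the matching edges are the pairs {v, m v}, v ∈ S).
HasPerfectMatching : ∀ {n} → Graph n → Subset n → Set
HasPerfectMatching {n} G S =
  Σ (Fin n → Fin n) λ m → ∀ v → v ∈ S →
    (m v ∈ S) × (m v ≢ v) × (m (m v) ≡ v) × G v (m v)

PMSetOfSize : ∀ {n} → Graph n → ℕ → Subset n → Set
PMSetOfSize G k S = (∣ S ∣ ≡ 2 * k) × HasPerfectMatching G S

-- "exactly c elements of A satisfy P": a duplicate-free list of length c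
-- whose members are exactly the elements satisfying P.
Count : {A : Set} → (A → Set) → ℕ → Set
Count {A} P c = Σ (List A) λ L → Unique L × (length L ≡ c) × (∀ x → (x ∈ₗ L) ⇔ P x)

-- p(G;z) = q : for every k, the number p_{2k} of perfectly matchable
-- sets of size 2k equals the coefficient of z^k in q.
MatchablePolyIs : ∀ {n} → Graph n → Poly → Set
MatchablePolyIs G q = ∀ k → ∃ λ c → Count (PMSetOfSize G k) c × (+ c ≡ q k)

-- Read a subset of the path P_m as a 0/1-word.  Vertex 0, if present, can only be matched to
-- vertex 1, so the perfectly matchable subsets are exactly the concatenations of the blocks 0
-- and 11; counting them by the number of 11-blocks gives the recurrence
-- u_{m+2} = u_{m+1} + z u_m.  On C_n the vertex 0 is unused, matched to 1, or matched to n-1,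
-- and removing it with its partner leaves a perfectly matchable subset of P_{n-1} or P_{n-2}.
-- This gives u_n + 2 z u_{n-1} = u_{n+1} + z u_{n-1}, except that the full vertex set lies in
-- both of the last two classes, which happens (with n/2 edges) exactly when n is even.
module Submission where

open import Defs
open import Data.Bool using (Bool; true; false)
import Data.Bool as Bool
open import Data.Empty using (⊥-elim)
open import Data.Fin using (Fin; zero; suc; toℕ; fromℕ)
import Data.Fin as Fin
open import Data.Fin.Properties using (toℕ-injective; toℕ-fromℕ; suc-injective)
open import Data.Fin.Subset using (Subset; _∈_; _⊆_; ∣_∣)
open import Data.Integer using (+_; _-_) renaming (_+_ to _+ℤ_)
import Data.Integer.Properties as Int
open import Algebra.Properties.AbelianGroup Int.+-0-abelianGroup using (//-rightDividesʳ)
open import Data.List using (List; []; [_]; map; _++_; length)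
open import Data.List.Properties using (length-map; length-++; ++-identityʳ)
open import Data.List.Membership.Propositional using () renaming (_∈_ to _∈ₗ_)
open import Data.List.Membership.Propositional.Properties
  using (∈-map⁺; ∈-map⁻; ∈-++⁺ˡ; ∈-++⁺ʳ; ∈-++⁻)
open import Data.List.Relation.Unary.Any using (here)
import Data.List.Relation.Unary.All as All
import Data.List.Relation.Unary.AllPairs as AllPairs
open import Data.List.Relation.Unary.Unique.Propositional using (Unique)
open import Data.List.Relation.Unary.Unique.Propositional.Properties using (map⁺; ++⁺)
import Data.List.Relation.Binary.Subset.Propositional.Properties as ⊆
open import Data.Nat using (ℕ; zero; suc; _+_; _*_; _∸_; pred; _≤_; s≤s; _%_; _/_)
import Data.Nat as Nat
open import Data.Nat.DivMod using (m≡m%n+[m/n]*n; m*n%n≡0)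
open import Data.Nat.Properties using (*-suc; *-comm; *-cancelˡ-≡; +-assoc; +-identityʳ)
open import Data.Product using (∃; _×_; _,_; proj₁; proj₂)
open import Data.Sum using (_⊎_; inj₁; inj₂)
open import Data.Vec using (Vec; []; _∷_; _∷ʳ_; replicate; initLast; _[_]=_; here; there)
open import Data.Vec.Properties using (∷-injectiveʳ; ∷ʳ-injectiveˡ; ≡-dec)
open import Function.Base using (_∘_)
open import Function.Bundles using (_⇔_; mk⇔)
open import Relation.Binary.Core using (_⇒_)
open import Relation.Binary.PropositionalEquality
  using (_≡_; _≢_; refl; sym; trans; cong; cong₂; subst; module ≡-Reasoning)
open import Relation.Nullary using (¬_; yes; no)

-- Perfect matchings

delete₀ : ∀ {n} → Graph (suc n) → Graph n
delete₀ G i j = G (suc i) (suc j)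

IsPerfectMatching : ∀ {n} → Graph n → Subset n → (Fin n → Fin n) → Set
IsPerfectMatching {n} G S m =
  ∀ v → v ∈ S → (m v ∈ S) × (m v ≢ v) × (m (m v) ≡ v) × G v (m v)

pm-map : ∀ {n} {G H : Graph n} {S} → G ⇒ H → HasPerfectMatching G S → HasPerfectMatching H S
pm-map G⇒H (m , P) = m , λ v v∈S → let (a , b , c , d) = P v v∈S in a , b , c , G⇒H d

pm-restrict : ∀ {n} {G H : Graph n} {S T : Subset n} (m : Fin n → Fin n) →
  IsPerfectMatching G S m → T ⊆ S → (∀ {x} → x ∈ T → m x ∈ S → m x ∈ T) →
  (∀ {x} → x ∈ T → G x (m x) → H x (m x)) → HasPerfectMatching H T
pm-restrict m P T⊆S closed edge = m , λ v v∈T →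
  let (a , b , c , d) = P v (T⊆S v∈T) in closed v∈T a , b , c , edge v∈T d

pm-drop₀ : ∀ {n} {G : Graph (suc n)} {S : Subset n} →
  HasPerfectMatching G (false ∷ S) → HasPerfectMatching (delete₀ G) S
pm-drop₀ {n} {G} {S} (m , P) = m′ , Q
  where
  -- vertex 0 is not in the set, so m sends no vertex of S to it and the default is never used
  unsuc : Fin (suc n) → Fin n → Fin n
  unsuc zero    default = default
  unsuc (suc j) _       = j
  m′ : Fin n → Fin n
  m′ v = unsuc (m (suc v)) v
  Q : IsPerfectMatching (delete₀ G) S m′
  Q v v∈S with P (suc v) (there v∈S)
  ... | m∈S , m≢v , inv , edge with m (suc v) | m∈S
  ... | zero  | ()
  ... | suc j | there j∈S =
    j∈S , m≢v ∘ cong suc , cong (λ i → unsuc i j) inv , edge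

pm-add₀ : ∀ {n} {G : Graph (suc n)} {S : Subset n} →
  HasPerfectMatching (delete₀ G) S → HasPerfectMatching G (false ∷ S)
pm-add₀ {n} {G} {S} (m , P) = m′ , Q
  where
  m′ : Fin (suc n) → Fin (suc n)
  m′ zero    = zero
  m′ (suc v) = suc (m v)
  Q : IsPerfectMatching G (false ∷ S) m′
  Q (suc v) (there v∈S) =
    let (a , b , c , d) = P v v∈S in there a , b ∘ suc-injective , cong suc c , d

pm-addEdge : ∀ {n} {G : Graph n} {S T : Subset n} (a b : Fin n) → a ≢ b → G a b → G b a →
  ¬ a ∈ T → ¬ b ∈ T → a ∈ S → b ∈ S → (∀ {x} → x ∈ S → x ∈ T ⊎ x ≡ a ⊎ x ≡ b) →
  T ⊆ S → HasPerfectMatching G T → HasPerfectMatching G S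
pm-addEdge {n} {G} {S} {T} a b a≢b gab gba a∉T b∉T a∈S b∈S cover T⊆S (m₀ , P) = m , Q
  where
  m : Fin n → Fin n
  m x with a Fin.≟ x | b Fin.≟ x
  ... | yes _ | _     = b
  ... | no _  | yes _ = a
  ... | no _  | no _  = m₀ x
  ma : m a ≡ b
  ma with a Fin.≟ a
  ... | yes _ = refl
  ... | no a≢a = ⊥-elim (a≢a refl)
  mb : m b ≡ a
  mb with a Fin.≟ b | b Fin.≟ b
  ... | yes a≡b | _     = ⊥-elim (a≢b a≡b)
  ... | no _    | yes _ = refl
  ... | no _    | no b≢b = ⊥-elim (b≢b refl)
  mT : ∀ {x} → x ∈ T → m x ≡ m₀ x
  mT {x} x∈T with a Fin.≟ x | b Fin.≟ x
  ... | yes refl | _        = ⊥-elim (a∉T x∈T)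
  ... | no _     | yes refl = ⊥-elim (b∉T x∈T)
  ... | no _     | no _     = refl
  Q : IsPerfectMatching G S m
  Q x x∈S with cover x∈S
  ... | inj₂ (inj₁ refl) =
    subst (_∈ S) (sym ma) b∈S , a≢b ∘ sym ∘ trans (sym ma) ,
    trans (cong m ma) mb , subst (G x) (sym ma) gab
  ... | inj₂ (inj₂ refl) =
    subst (_∈ S) (sym mb) a∈S , a≢b ∘ trans (sym mb) ,
    trans (cong m mb) ma , subst (G x) (sym mb) gba
  ... | inj₁ x∈T =
    let (p , q , r , s) = P x x∈T in
    subst (_∈ S) (sym (mT x∈T)) (T⊆S p) ,
    subst (_≢ x) (sym (mT x∈T)) q ,
    trans (cong m (mT x∈T)) (trans (mT p) r) ,
    subst (G x) (sym (mT x∈T)) s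

pm-addEdge₀₁ : ∀ {n} {G : Graph (2 + n)} {S : Subset n} → G zero (suc zero) → G (suc zero) zero →
  HasPerfectMatching G (false ∷ false ∷ S) → HasPerfectMatching G (true ∷ true ∷ S)
pm-addEdge₀₁ {G = G} g₀₁ g₁₀ =
  pm-addEdge {G = G} zero (suc zero) (λ ()) g₀₁ g₁₀ (λ ()) (λ { (there ()) }) here (there here)
    cover (λ { {suc (suc _)} (there (there p)) → there (there p) })
  where
  cover : ∀ {n} {S : Subset n} {x} → x ∈ true ∷ true ∷ S →
    x ∈ false ∷ false ∷ S ⊎ x ≡ zero ⊎ x ≡ suc zero
  cover here                = inj₂ (inj₁ refl)
  cover (there here)        = inj₂ (inj₂ refl)
  cover (there (there x∈S)) = inj₁ (there (there x∈S))

pm-removeEdge₀₁ : ∀ {n} {G : Graph (2 + n)} {S : Subset n} {m : Fin (2 + n) → Fin (2 + n)} →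
  IsPerfectMatching G (true ∷ true ∷ S) m → m zero ≡ suc zero →
  HasPerfectMatching G (false ∷ false ∷ S)
pm-removeEdge₀₁ {G = G} {S = S} {m} P m₀≡1 =
  pm-restrict {G = G} {H = G} m P T⊆S closed (λ _ g → g)
  where
  m₁≡0 : m (suc zero) ≡ zero
  m₁≡0 = trans (cong m (sym m₀≡1)) (proj₁ (proj₂ (proj₂ (P zero here))))
  T⊆S : false ∷ false ∷ S ⊆ true ∷ true ∷ S
  T⊆S {suc (suc _)} (there (there p)) = there (there p)
  closed : ∀ {x} → x ∈ false ∷ false ∷ S → m x ∈ true ∷ true ∷ S →
    m x ∈ false ∷ false ∷ S
  closed {suc (suc x)} (there (there p)) q with P (suc (suc x)) (there (there p))
  ... | _ , _ , inv , _ with m (suc (suc x))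
  ... | zero     with () ← trans (sym inv) m₀≡1
  ... | suc zero with () ← trans (sym inv) m₁≡0
  closed (there (there p)) (there (there q)) | _ | suc (suc _) = there (there q)

pm-split₀₁ : ∀ {n} {G : Graph (2 + n)} {S : Subset (suc n)} {m : Fin (2 + n) → Fin (2 + n)} →
  IsPerfectMatching G (true ∷ S) m → m zero ≡ suc zero →
  ∃ λ S′ → S ≡ true ∷ S′ × HasPerfectMatching (delete₀ (delete₀ G)) S′
pm-split₀₁ {G = G} {S = c ∷ S′} P m₀≡1 with subst (_∈ true ∷ c ∷ S′) m₀≡1 (proj₁ (P zero here))
... | there here =
  S′ , refl , pm-drop₀ {G = delete₀ G} (pm-drop₀ {G = G} (pm-removeEdge₀₁ {G = G} P m₀≡1))

-- Tilings

data Tiling : ∀ {m} → Vec Bool m → ℕ → Set where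
  []   : Tiling [] 0
  gap  : ∀ {m} {v : Vec Bool m} {k} → Tiling v k → Tiling (false ∷ v) k
  pair : ∀ {m} {v : Vec Bool m} {k} → Tiling v k → Tiling (true ∷ true ∷ v) (suc k)

pair∷ : ∀ {m} → Vec Bool m → Vec Bool (2 + m)
pair∷ v = true ∷ true ∷ v

pair∷-injective : ∀ {m} {v w : Vec Bool m} → pair∷ v ≡ pair∷ w → v ≡ w
pair∷-injective refl = refl

full : ∀ m → Vec Bool m
full m = replicate m true

tiling-size : ∀ {m} {S : Vec Bool m} {k} → Tiling S k → ∣ S ∣ ≡ 2 * k
tiling-size []               = refl
tiling-size (gap t)          = tiling-size t
tiling-size {k = suc k} (pair t) = trans (cong (λ n → 2 + n) (tiling-size t)) (sym (*-suc 2 k))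

tilings : (m k : ℕ) → List (Vec Bool m)
tilings zero          zero    = [ [] ]
tilings zero          (suc k) = []
tilings (suc zero)    k       = map (false ∷_) (tilings zero k)
tilings (suc (suc m)) zero    = map (false ∷_) (tilings (suc m) zero)
tilings (suc (suc m)) (suc k) = map (false ∷_) (tilings (suc m) (suc k)) ++ map pair∷ (tilings m k)

nonFullTilings : (m k : ℕ) → List (Vec Bool m)
nonFullTilings zero          k       = []
nonFullTilings (suc zero)    k       = map (false ∷_) (tilings zero k)
nonFullTilings (suc (suc m)) zero    = map (false ∷_) (tilings (suc m) zero)
nonFullTilings (suc (suc m)) (suc k) =
  map (false ∷_) (tilings (suc m) (suc k)) ++ map pair∷ (nonFullTilings m k)

δ : ℕ → ℕ → ℕ
δ zero          zero    = 1
δ zero          (suc k) = 0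
δ (suc zero)    k       = 0
δ (suc (suc m)) zero    = 0
δ (suc (suc m)) (suc k) = δ m k

δ-2* : ∀ k → δ (2 * k) k ≡ 1
δ-2* zero = refl
δ-2* (suc k) rewrite *-suc 2 k = δ-2* k

δ-≢2* : ∀ m k → m ≢ 2 * k → δ m k ≡ 0
δ-≢2* zero          zero    m≢2k = ⊥-elim (m≢2k refl)
δ-≢2* zero          (suc k) _    = refl
δ-≢2* (suc zero)    k       _    = refl
δ-≢2* (suc (suc m)) zero    _    = refl
δ-≢2* (suc (suc m)) (suc k) m≢2k =
  δ-≢2* m k (λ m≡2k → m≢2k (trans (cong (λ n → 2 + n) m≡2k) (sym (*-suc 2 k))))

∈-gaps⁻ : ∀ {m k} {xs : List (Vec Bool m)} {x} → x ∈ₗ map (false ∷_) xs →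
  (∀ {y} → y ∈ₗ xs → Tiling y k) → Tiling x k
∈-gaps⁻ x∈ sound with ∈-map⁻ (false ∷_) x∈
... | _ , y∈ , refl = gap (sound y∈)

∈-pairs⁻ : ∀ {m k} {xs : List (Vec Bool m)} {x} → x ∈ₗ map pair∷ xs →
  (∀ {y} → y ∈ₗ xs → Tiling y k) → Tiling x (suc k)
∈-pairs⁻ x∈ sound with ∈-map⁻ pair∷ x∈
... | _ , y∈ , refl = pair (sound y∈)

∈-gaps++pairs⁻ : ∀ {m k} {xs : List (Vec Bool (suc m))} {ys : List (Vec Bool m)} {x} →
  x ∈ₗ map (false ∷_) xs ++ map pair∷ ys →
  (∀ {y} → y ∈ₗ xs → Tiling y (suc k)) → (∀ {y} → y ∈ₗ ys → Tiling y k) → Tiling x (suc k)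
∈-gaps++pairs⁻ {xs = xs} x∈ xs-sound ys-sound with ∈-++⁻ (map (false ∷_) xs) x∈
... | inj₁ x∈gaps  = ∈-gaps⁻ x∈gaps xs-sound
... | inj₂ x∈pairs = ∈-pairs⁻ x∈pairs ys-sound

tilings-sound : ∀ m k {x} → x ∈ₗ tilings m k → Tiling x k
tilings-sound zero          zero    {[]} _ = []
tilings-sound (suc zero)    k       x∈ = ∈-gaps⁻ x∈ (tilings-sound zero k)
tilings-sound (suc (suc m)) zero    x∈ = ∈-gaps⁻ x∈ (tilings-sound (suc m) zero)
tilings-sound (suc (suc m)) (suc k) x∈ =
  ∈-gaps++pairs⁻ x∈ (tilings-sound (suc m) (suc k)) (tilings-sound m k)

tilings-complete : ∀ {m k} {x : Vec Bool m} → Tiling x k → x ∈ₗ tilings m k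
tilings-complete []                              = here refl
tilings-complete {suc zero}            (gap t)  = ∈-map⁺ (false ∷_) (tilings-complete t)
tilings-complete {suc (suc m)} {zero}  (gap t)  = ∈-map⁺ (false ∷_) (tilings-complete t)
tilings-complete {suc (suc m)} {suc k} (gap t)  = ∈-++⁺ˡ (∈-map⁺ (false ∷_) (tilings-complete t))
tilings-complete                       (pair t) =
  ∈-++⁺ʳ (map (false ∷_) (tilings _ _)) (∈-map⁺ pair∷ (tilings-complete t))

∈-gaps-≢full : ∀ {m} {xs : List (Vec Bool m)} {x} → x ∈ₗ map (false ∷_) xs → x ≢ full (suc m)
∈-gaps-≢full x∈ with ∈-map⁻ (false ∷_) x∈
... | _ , _ , refl = λ ()

nonFullTilings-≢full : ∀ m k {x} → x ∈ₗ nonFullTilings m k → x ≢ full m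
nonFullTilings-≢full (suc zero)    k       x∈ = ∈-gaps-≢full x∈
nonFullTilings-≢full (suc (suc m)) zero    x∈ = ∈-gaps-≢full x∈
nonFullTilings-≢full (suc (suc m)) (suc k) x∈ with ∈-++⁻ (map (false ∷_) (tilings (suc m) (suc k))) x∈
... | inj₁ x∈gaps  = ∈-gaps-≢full x∈gaps
... | inj₂ x∈pairs with ∈-map⁻ pair∷ x∈pairs
...   | y , y∈ , refl = nonFullTilings-≢full m k y∈ ∘ pair∷-injective

nonFullTilings⊆tilings : ∀ m k {x} → x ∈ₗ nonFullTilings m k → x ∈ₗ tilings m k
nonFullTilings⊆tilings (suc zero)    k       = ⊆.⊆-refl
nonFullTilings⊆tilings (suc (suc m)) zero    = ⊆.⊆-refl
nonFullTilings⊆tilings (suc (suc m)) (suc k) =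
  ⊆.++⁺ ⊆.⊆-refl (⊆.map⁺ pair∷ (nonFullTilings⊆tilings m k))

nonFullTilings-complete : ∀ {m k} {x : Vec Bool m} → Tiling x k → x ≢ full m →
  x ∈ₗ nonFullTilings m k
nonFullTilings-complete []                         x≢full = ⊥-elim (x≢full refl)
nonFullTilings-complete {suc zero}            (gap t)  _ = ∈-map⁺ (false ∷_) (tilings-complete t)
nonFullTilings-complete {suc (suc m)} {zero}  (gap t)  _ = ∈-map⁺ (false ∷_) (tilings-complete t)
nonFullTilings-complete {suc (suc m)} {suc k} (gap t)  _ = ∈-++⁺ˡ (∈-map⁺ (false ∷_) (tilings-complete t))
nonFullTilings-complete                       (pair t) x≢full =
  ∈-++⁺ʳ (map (false ∷_) (tilings _ _))
    (∈-map⁺ pair∷ (nonFullTilings-complete t (x≢full ∘ cong pair∷)))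

gaps-disjoint-pairs : ∀ {m} {xs : List (Vec Bool (suc m))} {ys : List (Vec Bool m)} {x} →
  ¬ (x ∈ₗ map (false ∷_) xs × x ∈ₗ map pair∷ ys)
gaps-disjoint-pairs (x∈gaps , x∈pairs) with ∈-map⁻ (false ∷_) x∈gaps | ∈-map⁻ pair∷ x∈pairs
... | _ , _ , refl | _ , _ , ()

tilings-unique : ∀ m k → Unique (tilings m k)
tilings-unique zero          zero    = All.[] AllPairs.∷ AllPairs.[]
tilings-unique zero          (suc k) = AllPairs.[]
tilings-unique (suc zero)    k       = map⁺ ∷-injectiveʳ (tilings-unique zero k)
tilings-unique (suc (suc m)) zero    = map⁺ ∷-injectiveʳ (tilings-unique (suc m) zero)
tilings-unique (suc (suc m)) (suc k) =
  ++⁺ (map⁺ ∷-injectiveʳ (tilings-unique (suc m) (suc k)))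
      (map⁺ pair∷-injective (tilings-unique m k)) gaps-disjoint-pairs

nonFullTilings-unique : ∀ m k → Unique (nonFullTilings m k)
nonFullTilings-unique zero          k       = AllPairs.[]
nonFullTilings-unique (suc zero)    k       = map⁺ ∷-injectiveʳ (tilings-unique zero k)
nonFullTilings-unique (suc (suc m)) zero    = map⁺ ∷-injectiveʳ (tilings-unique (suc m) zero)
nonFullTilings-unique (suc (suc m)) (suc k) =
  ++⁺ (map⁺ ∷-injectiveʳ (tilings-unique (suc m) (suc k)))
      (map⁺ pair∷-injective (nonFullTilings-unique m k)) gaps-disjoint-pairs

length-map++map : ∀ {A B C : Set} (f : A → C) (g : B → C) xs ys →
  length (map f xs ++ map g ys) ≡ length xs + length ys
length-map++map f g xs ys = trans (length-++ (map f xs)) (cong₂ _+_ (length-map f xs) (length-map g ys))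

length-nonFullTilings : ∀ m k → length (tilings m k) ≡ length (nonFullTilings m k) + δ m k
length-nonFullTilings zero          zero    = refl
length-nonFullTilings zero          (suc k) = refl
length-nonFullTilings (suc zero)    k       = sym (+-identityʳ _)
length-nonFullTilings (suc (suc m)) zero    = sym (+-identityʳ _)
length-nonFullTilings (suc (suc m)) (suc k) = begin
  length (map (false ∷_) gaps ++ map pair∷ (tilings m k))
    ≡⟨ length-map++map _ _ gaps _ ⟩
  length gaps + length (tilings m k)
    ≡⟨ cong (λ n → length gaps + n) (length-nonFullTilings m k) ⟩
  length gaps + (length (nonFullTilings m k) + δ m k)
    ≡⟨ +-assoc (length gaps) _ _ ⟨
  length gaps + length (nonFullTilings m k) + δ m k
    ≡⟨ cong (_+ δ m k) (length-map++map _ _ gaps _) ⟨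
  length (map (false ∷_) gaps ++ map pair∷ (nonFullTilings m k)) + δ m k ∎
  where
  open ≡-Reasoning
  gaps = tilings (suc m) (suc k)

length-tilings : ∀ m k → + length (tilings m k) ≡ u (suc m) k
length-tilings zero          zero    = refl
length-tilings zero          (suc k) = refl
length-tilings (suc zero)    zero    = refl
length-tilings (suc zero)    (suc k) = refl
length-tilings (suc (suc m)) zero    = begin
  + length (map (false ∷_) gaps) ≡⟨ cong +_ (length-map (false ∷_) gaps) ⟩
  + length gaps                  ≡⟨ length-tilings (suc m) zero ⟩
  u (2 + m) zero                 ≡⟨ Int.+-identityʳ _ ⟨
  u (3 + m) zero                 ∎
  where
  open ≡-Reasoning
  gaps = tilings (suc m) zero
length-tilings (suc (suc m)) (suc k) = begin
  + length (map (false ∷_) (tilings (suc m) (suc k)) ++ map pair∷ (tilings m k))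
    ≡⟨ cong +_ (length-map++map _ _ (tilings (suc m) (suc k)) _) ⟩
  + (length (tilings (suc m) (suc k)) + length (tilings m k))
    ≡⟨ Int.pos-+ (length (tilings (suc m) (suc k))) _ ⟩
  + length (tilings (suc m) (suc k)) +ℤ + length (tilings m k)
    ≡⟨ cong₂ _+ℤ_ (length-tilings (suc m) (suc k)) (length-tilings m k) ⟩
  u (3 + m) (suc k) ∎
  where open ≡-Reasoning

wrap : ∀ {m} → Vec Bool m → Vec Bool (2 + m)
wrap w = true ∷ (w ∷ʳ true)

-- Tilings of true ∷ b and of b ∷ʳ true have their blocks offset by one position, which
-- forces every position of b to be true.
mutual
  tiling-shifted⇒full : ∀ {m} (b : Vec Bool m) {j j′} →
    Tiling (true ∷ b) j → Tiling (b ∷ʳ true) j′ → b ≡ full m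
  tiling-shifted⇒full (_ ∷ b) (pair t) t′ = cong (true ∷_) (tiling-wrap⇒full b t t′)

  tiling-wrap⇒full : ∀ {m} (b : Vec Bool m) {j j′} →
    Tiling b j → Tiling (wrap b) j′ → b ≡ full m
  tiling-wrap⇒full []      _ _        = refl
  tiling-wrap⇒full (_ ∷ b) t (pair t′) = cong (true ∷_) (tiling-shifted⇒full b t t′)

pair∷≡wrap⇒full : ∀ {m} {a w : Vec Bool (suc m)} {j j′} →
  Tiling a j → Tiling w j′ → pair∷ a ≡ wrap w → w ≡ full (suc m)
pair∷≡wrap⇒full {w = true ∷ b} ta tw refl = cong (true ∷_) (tiling-shifted⇒full b tw ta)

-- Paths

Path-delete₀ : ∀ {n} → delete₀ (Path (suc n)) ⇒ Path n
Path-delete₀ (inj₁ e) = inj₁ (cong pred e)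
Path-delete₀ (inj₂ e) = inj₂ (cong pred e)

Path⇒delete₀ : ∀ {n} → Path n ⇒ delete₀ (Path (suc n))
Path⇒delete₀ (inj₁ e) = inj₁ (cong suc e)
Path⇒delete₀ (inj₂ e) = inj₂ (cong suc e)

pm-gap : ∀ {n} {G : Graph (suc n)} {w : Subset n} →
  Path n ⇒ delete₀ G → HasPerfectMatching (Path n) w → HasPerfectMatching G (false ∷ w)
pm-gap {n} {G} Path⇒G pm = pm-add₀ {G = G} (pm-map {G = Path n} {H = delete₀ G} Path⇒G pm)

pm-pair : ∀ {n} {G : Graph (2 + n)} {w : Subset n} → Path n ⇒ delete₀ (delete₀ G) →
  G zero (suc zero) → G (suc zero) zero →
  HasPerfectMatching (Path n) w → HasPerfectMatching G (pair∷ w)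
pm-pair {n} {G} Path⇒G g₀₁ g₁₀ pm =
  pm-addEdge₀₁ {G = G} g₀₁ g₁₀ (pm-add₀ {G = G} (pm-add₀ {G = delete₀ G}
    (pm-map {G = Path n} {H = delete₀ (delete₀ G)} Path⇒G pm)))

tiling⇒pm : ∀ {n} {S : Subset n} {k} → Tiling S k → HasPerfectMatching (Path n) S
tiling⇒pm []                   = (λ v → v) , λ _ ()
tiling⇒pm {suc n}       (gap t)  = pm-gap {G = Path (suc n)} Path⇒delete₀ (tiling⇒pm t)
tiling⇒pm {suc (suc n)} (pair t) =
  pm-pair {G = Path (2 + n)} (λ g → Path⇒delete₀ (Path⇒delete₀ g)) (inj₁ refl) (inj₂ refl)
    (tiling⇒pm t)

pm⇒tiling : ∀ {n} {S : Subset n} → HasPerfectMatching (Path n) S → ∃ (Tiling S)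
pm⇒tiling {zero}  {[]}        _  = 0 , []
pm⇒tiling {suc n} {false ∷ S} pm =
  let j , t = pm⇒tiling (pm-map {H = Path n} Path-delete₀ (pm-drop₀ {G = Path (suc n)} pm)) in j , gap t
pm⇒tiling {suc zero} {true ∷ []} (m , P) with P zero here
... | _ , _ , _ , inj₂ ()
... | _ , _ , _ , inj₁ 1≡m₀ with m zero
...   | zero with () ← 1≡m₀
pm⇒tiling {suc (suc n)} {true ∷ S} (m , P) with P zero here
... | _ , _ , _ , inj₂ ()
... | _ , _ , _ , inj₁ 1≡m₀ with pm-split₀₁ {G = Path (2 + n)} P (toℕ-injective (sym 1≡m₀))
...   | S′ , refl , pm′ =
  let j , t = pm⇒tiling (pm-map {H = Path n} (λ g → Path-delete₀ (Path-delete₀ g)) pm′)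
  in suc j , pair t

size≡2*-injective : ∀ {n} {S : Subset n} {j k} → ∣ S ∣ ≡ 2 * j → ∣ S ∣ ≡ 2 * k → j ≡ k
size≡2*-injective {j = j} {k} size≡2j size≡2k = *-cancelˡ-≡ j k 2 (trans (sym size≡2j) size≡2k)

matchablePoly-fromLists : ∀ {n} {G : Graph n} {q : Poly} (sets : ℕ → List (Subset n)) →
  (∀ k → Unique (sets k)) → (∀ k S → S ∈ₗ sets k ⇔ PMSetOfSize G k S) →
  (∀ k → + length (sets k) ≡ q k) → MatchablePolyIs G q
matchablePoly-fromLists sets unique ∈⇔ count k =
  length (sets k) , (sets k , unique k , refl , ∈⇔ k) , count k

path-matchablePoly : ∀ n → MatchablePolyIs (Path n) (u (suc n))
path-matchablePoly n =
  matchablePoly-fromLists {G = Path n} (tilings n) (tilings-unique n) ∈⇔ (length-tilings n)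
  where
  ∈⇔ : ∀ k S → S ∈ₗ tilings n k ⇔ PMSetOfSize (Path n) k S
  ∈⇔ k S = mk⇔ (λ S∈ → let t = tilings-sound n k S∈ in tiling-size t , tiling⇒pm t)
               (λ (size , pm) → let j , t = pm⇒tiling pm in
                 tilings-complete (subst (Tiling S) (size≡2*-injective {S = S} {k = k} (tiling-size t) size) t))

-- Cycles

∷ʳ-[]=-last⁻ : ∀ {m} (w : Vec Bool m) c (i : Fin (suc m)) {y} → toℕ i ≡ m →
  (w ∷ʳ c) [ i ]= y → y ≡ c
∷ʳ-[]=-last⁻ []      c zero    _ here      = refl
∷ʳ-[]=-last⁻ (_ ∷ w) c (suc i) e (there p) = ∷ʳ-[]=-last⁻ w c i (cong pred e) p

∷ʳ-[]=-last⁺ : ∀ {m} (w : Vec Bool m) c → (w ∷ʳ c) [ fromℕ m ]= c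
∷ʳ-[]=-last⁺ []      c = here
∷ʳ-[]=-last⁺ (_ ∷ w) c = there (∷ʳ-[]=-last⁺ w c)

∷ʳ-[]=-init : ∀ {m} (w : Vec Bool m) c c′ (i : Fin (suc m)) {y} → toℕ i ≢ m →
  (w ∷ʳ c) [ i ]= y → (w ∷ʳ c′) [ i ]= y
∷ʳ-[]=-init []      _ _  zero    i≢last here      = ⊥-elim (i≢last refl)
∷ʳ-[]=-init (_ ∷ w) _ _  zero    _      here      = here
∷ʳ-[]=-init (_ ∷ w) c c′ (suc i) i≢last (there p) =
  there (∷ʳ-[]=-init w c c′ i (i≢last ∘ cong suc) p)

∈∷ʳfalse⇒≢last : ∀ {m} (w : Vec Bool m) (i : Fin (suc m)) → i ∈ w ∷ʳ false → toℕ i ≢ m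
∈∷ʳfalse⇒≢last w i i∈ i≡last with () ← ∷ʳ-[]=-last⁻ w false i i≡last i∈

∣∷ʳtrue∣ : ∀ {m} (w : Vec Bool m) → ∣ w ∷ʳ true ∣ ≡ suc ∣ w ∣
∣∷ʳtrue∣ []          = refl
∣∷ʳtrue∣ (true ∷ w)  = cong suc (∣∷ʳtrue∣ w)
∣∷ʳtrue∣ (false ∷ w) = ∣∷ʳtrue∣ w

tiling-∷ʳfalse⁺ : ∀ {m} {w : Vec Bool m} {j} → Tiling w j → Tiling (w ∷ʳ false) j
tiling-∷ʳfalse⁺ []       = gap []
tiling-∷ʳfalse⁺ (gap t)  = gap (tiling-∷ʳfalse⁺ t)
tiling-∷ʳfalse⁺ (pair t) = pair (tiling-∷ʳfalse⁺ t)

tiling-∷ʳfalse⁻ : ∀ {m} (w : Vec Bool m) {j} → Tiling (w ∷ʳ false) j → Tiling w j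
tiling-∷ʳfalse⁻ []              (gap [])  = []
tiling-∷ʳfalse⁻ (_ ∷ [])        (gap t)   = gap (tiling-∷ʳfalse⁻ [] t)
tiling-∷ʳfalse⁻ (_ ∷ x ∷ w)     (gap t)   = gap (tiling-∷ʳfalse⁻ (x ∷ w) t)
tiling-∷ʳfalse⁻ (_ ∷ _ ∷ w)     (pair t)  = pair (tiling-∷ʳfalse⁻ w t)

Cycle-delete₀ : ∀ {r} → delete₀ (Cycle (3 + r)) ⇒ Path (2 + r)
Cycle-delete₀ (inj₁ p)               = Path-delete₀ p
Cycle-delete₀ (inj₂ (inj₁ (() , _)))
Cycle-delete₀ (inj₂ (inj₂ (() , _)))

data CycleShape {r} : Subset (3 + r) → ℕ → Set where
  gap₀   : ∀ {w k} → Tiling w k → CycleShape (false ∷ w) k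
  pair₀₁ : ∀ {w k} → Tiling w k → CycleShape (pair∷ w) (suc k)
  wrap₀  : ∀ {w k} → Tiling w k → CycleShape (wrap w) (suc k)

cycleShape-size : ∀ {r} {S : Subset (3 + r)} {k} → CycleShape S k → ∣ S ∣ ≡ 2 * k
cycleShape-size (gap₀ t)      = tiling-size t
cycleShape-size (pair₀₁ t)    = tiling-size (pair t)
cycleShape-size (wrap₀ {w} t) = trans (cong suc (∣∷ʳtrue∣ w)) (tiling-size (pair t))

pm-wrap : ∀ {r} {w : Vec Bool (suc r)} {k} → Tiling w k → HasPerfectMatching (Cycle (3 + r)) (wrap w)
pm-wrap {r} {w} t = pm-addEdge {G = Cycle (3 + r)} {T = false ∷ (w ∷ʳ false)} zero last (λ ())
  (inj₂ (inj₁ (refl , last-toℕ))) (inj₂ (inj₂ (refl , last-toℕ)))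
  (λ ()) last∉T here (there (∷ʳ-[]=-last⁺ w true)) cover T⊆S
  (pm-map {G = Path (3 + r)} {H = Cycle (3 + r)} inj₁ (tiling⇒pm (gap (tiling-∷ʳfalse⁺ t))))
  where
  last : Fin (3 + r)
  last = suc (fromℕ (suc r))
  last-toℕ : suc (toℕ last) ≡ 3 + r
  last-toℕ = cong (λ n → 2 + n) (toℕ-fromℕ (suc r))
  last∉T : ¬ last ∈ false ∷ (w ∷ʳ false)
  last∉T (there p) with () ← ∷ʳ-[]=-last⁻ w false (fromℕ (suc r)) (toℕ-fromℕ _) p
  cover : ∀ {x} → x ∈ wrap w → x ∈ false ∷ (w ∷ʳ false) ⊎ x ≡ zero ⊎ x ≡ last
  cover here = inj₂ (inj₁ refl)
  cover {suc i} (there p) with toℕ i Nat.≟ suc r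
  ... | yes i≡last = inj₂ (inj₂ (cong suc (toℕ-injective (trans i≡last (sym (toℕ-fromℕ _))))))
  ... | no i≢last  = inj₁ (there (∷ʳ-[]=-init w true false i i≢last p))
  T⊆S : false ∷ (w ∷ʳ false) ⊆ wrap w
  T⊆S {suc i} (there p) = there (∷ʳ-[]=-init w false true i (∈∷ʳfalse⇒≢last w i p) p)

cycleShape⇒pm : ∀ {r} {S : Subset (3 + r)} {k} → CycleShape S k →
  HasPerfectMatching (Cycle (3 + r)) S
cycleShape⇒pm {r} (gap₀ t)   =
  pm-gap {G = Cycle (3 + r)} (λ g → inj₁ (Path⇒delete₀ g)) (tiling⇒pm t)
cycleShape⇒pm {r} (pair₀₁ t) =
  pm-pair {G = Cycle (3 + r)} (λ g → inj₁ (Path⇒delete₀ (Path⇒delete₀ g)))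
    (inj₁ (inj₁ refl)) (inj₁ (inj₂ refl)) (tiling⇒pm t)
cycleShape⇒pm (wrap₀ t)      = pm-wrap t

pm-wrap⁻ : ∀ {r} (w : Vec Bool (suc r)) {m : Fin (3 + r) → Fin (3 + r)} →
  IsPerfectMatching (Cycle (3 + r)) (wrap w) m → suc (toℕ (m zero)) ≡ 3 + r → ∃ (Tiling w)
pm-wrap⁻ {r} w {m} P m₀-last
  with pm⇒tiling (pm-restrict {G = Cycle (3 + r)} {H = Path (3 + r)} {T = false ∷ (w ∷ʳ false)}
                   m P T⊆S closed edge)
  where
  T⊆S : false ∷ (w ∷ʳ false) ⊆ wrap w
  T⊆S {suc i} (there p) = there (∷ʳ-[]=-init w false true i (∈∷ʳfalse⇒≢last w i p) p)
  m-m₀ : m (m zero) ≡ zero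
  m-m₀ = proj₁ (proj₂ (proj₂ (P zero here)))
  toℕ-m₀ : toℕ (m zero) ≡ 2 + r
  toℕ-m₀ = cong pred m₀-last
  closed : ∀ {x} → x ∈ false ∷ (w ∷ʳ false) → m x ∈ wrap w → m x ∈ false ∷ (w ∷ʳ false)
  closed {suc i} (there p) mx∈S with P (suc i) (T⊆S (there p))
  ... | _ , _ , inv , _ with m (suc i) | mx∈S
  ...   | zero  | _ = ⊥-elim (∈∷ʳfalse⇒≢last w i p (cong pred (trans (cong toℕ (sym inv)) toℕ-m₀)))
  ...   | suc j | there q with toℕ j Nat.≟ suc r
  ...     | no j≢last = there (∷ʳ-[]=-init w true false j j≢last q)
  ...     | yes j≡last
    with () ← trans (sym inv) (trans (cong m (toℕ-injective (trans (cong suc j≡last) (sym toℕ-m₀)))) m-m₀)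
  edge : ∀ {x} → x ∈ false ∷ (w ∷ʳ false) → Cycle (3 + r) x (m x) → Path (3 + r) x (m x)
  edge _ (inj₁ g) = g
  edge {suc i} _ (inj₂ (inj₁ (() , _)))
  edge {suc i} (there p) (inj₂ (inj₂ (_ , x-last))) =
    ⊥-elim (∈∷ʳfalse⇒≢last w i p (cong (λ n → pred (pred n)) x-last))
... | j , gap t = j , tiling-∷ʳfalse⁻ w t

pm⇒cycleShape : ∀ {r} {S : Subset (3 + r)} → HasPerfectMatching (Cycle (3 + r)) S →
  ∃ (CycleShape S)
pm⇒cycleShape {r} {false ∷ S} pm =
  let j , t = pm⇒tiling (pm-map {H = Path (2 + r)} Cycle-delete₀ (pm-drop₀ {G = Cycle (3 + r)} pm))
  in j , gap₀ t
pm⇒cycleShape {r} {true ∷ S} (m , P) with P zero here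
... | _ , _ , _ , inj₁ (inj₂ ())
... | _ , _ , _ , inj₂ (inj₂ (_ , ()))
... | m₀∈S , _ , _ , inj₂ (inj₁ (_ , m₀-last)) with initLast S
...   | w , c , refl with ∷ʳ-[]=-last⁻ (true ∷ w) c (m zero) (cong pred m₀-last) m₀∈S
...     | refl = let j , t = pm-wrap⁻ w P m₀-last in suc j , wrap₀ t
pm⇒cycleShape {r} {true ∷ S} (m , P) | _ , _ , _ , inj₁ (inj₁ 1≡m₀)
  with pm-split₀₁ {G = Cycle (3 + r)} P (toℕ-injective (sym 1≡m₀))
... | S′ , refl , pm′ =
  let j , t = pm⇒tiling (pm-map {H = Path (1 + r)} (λ g → Path-delete₀ (Cycle-delete₀ g)) pm′)
  in suc j , pair₀₁ t

full-∷ʳ : ∀ m → full m ∷ʳ true ≡ full (suc m)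
full-∷ʳ zero    = refl
full-∷ʳ (suc m) = cong (true ∷_) (full-∷ʳ m)

wrap-full : ∀ m → wrap (full m) ≡ pair∷ (full m)
wrap-full m = cong (true ∷_) (full-∷ʳ m)

wrap-injective : ∀ {m} {v w : Vec Bool m} → wrap v ≡ wrap w → v ≡ w
wrap-injective {v = v} {w} e = ∷ʳ-injectiveˡ v w (∷-injectiveʳ e)

-- wrap (full _) is already listed as pair∷ (full _) (wrap-full), so only non-full wraps are.
matched₀Sets : (r k : ℕ) → List (Subset (3 + r))
matched₀Sets r zero    = []
matched₀Sets r (suc k) = map pair∷ (tilings (1 + r) k) ++ map wrap (nonFullTilings (1 + r) k)

cycleSets : (r k : ℕ) → List (Subset (3 + r))
cycleSets r k = map (false ∷_) (tilings (2 + r) k) ++ matched₀Sets r k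

∈-cycleSets⁻ : ∀ r k {S} → S ∈ₗ cycleSets r k → CycleShape S k
∈-cycleSets⁻ r k S∈ with ∈-++⁻ (map (false ∷_) (tilings (2 + r) k)) S∈
... | inj₁ S∈gaps with ∈-map⁻ (false ∷_) S∈gaps
...   | _ , w∈ , refl = gap₀ (tilings-sound (2 + r) k w∈)
∈-cycleSets⁻ r zero    S∈ | inj₂ ()
∈-cycleSets⁻ r (suc k) S∈ | inj₂ S∈matched
  with ∈-++⁻ (map pair∷ (tilings (1 + r) k)) S∈matched
... | inj₁ S∈pairs with ∈-map⁻ pair∷ S∈pairs
...   | _ , w∈ , refl = pair₀₁ (tilings-sound (1 + r) k w∈)
∈-cycleSets⁻ r (suc k) S∈ | inj₂ S∈matched | inj₂ S∈wraps with ∈-map⁻ wrap S∈wraps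
...   | _ , w∈ , refl = wrap₀ (tilings-sound (1 + r) k (nonFullTilings⊆tilings (1 + r) k w∈))

∈-cycleSets⁺ : ∀ r {k S} → CycleShape S k → S ∈ₗ cycleSets r k
∈-cycleSets⁺ r         (gap₀ t)   = ∈-++⁺ˡ (∈-map⁺ (false ∷_) (tilings-complete t))
∈-cycleSets⁺ r {suc k} (pair₀₁ t) =
  ∈-++⁺ʳ (map (false ∷_) (tilings (2 + r) (suc k))) (∈-++⁺ˡ (∈-map⁺ pair∷ (tilings-complete t)))
∈-cycleSets⁺ r {suc k} (wrap₀ {w} t) with ≡-dec Bool._≟_ w (full (suc r))
... | yes refl  =
  subst (_∈ₗ cycleSets r (suc k)) (sym (wrap-full (suc r))) (∈-cycleSets⁺ r (pair₀₁ t))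
... | no w≢full = ∈-++⁺ʳ (map (false ∷_) (tilings (2 + r) (suc k)))
  (∈-++⁺ʳ (map pair∷ (tilings (1 + r) k)) (∈-map⁺ wrap (nonFullTilings-complete t w≢full)))

cycleSets-unique : (r k : ℕ) → Unique (cycleSets r k)
cycleSets-unique r zero    =
  ++⁺ (map⁺ ∷-injectiveʳ (tilings-unique (2 + r) zero)) AllPairs.[] (λ { (_ , ()) })
cycleSets-unique r (suc k) =
  ++⁺ (map⁺ ∷-injectiveʳ (tilings-unique (2 + r) (suc k)))
      (++⁺ (map⁺ pair∷-injective (tilings-unique (1 + r) k))
           (map⁺ wrap-injective (nonFullTilings-unique (1 + r) k))
           pairs-disjoint-wraps)
      gaps-disjoint-matched
  where
  pairs = tilings (1 + r) k
  wraps = nonFullTilings (1 + r) k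
  pairs-disjoint-wraps : ∀ {S} → ¬ (S ∈ₗ map pair∷ pairs × S ∈ₗ map wrap wraps)
  pairs-disjoint-wraps (S∈pairs , S∈wraps) with ∈-map⁻ pair∷ S∈pairs | ∈-map⁻ wrap S∈wraps
  ... | a , a∈ , refl | w , w∈ , e = nonFullTilings-≢full (1 + r) k w∈ (pair∷≡wrap⇒full
    (tilings-sound (1 + r) k a∈) (tilings-sound (1 + r) k (nonFullTilings⊆tilings (1 + r) k w∈)) e)
  gaps-disjoint-matched : ∀ {S} →
    ¬ (S ∈ₗ map (false ∷_) (tilings (2 + r) (suc k)) × S ∈ₗ matched₀Sets r (suc k))
  gaps-disjoint-matched (S∈gaps , S∈matched)
    with ∈-map⁻ (false ∷_) S∈gaps | ∈-++⁻ (map pair∷ pairs) S∈matched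
  ... | _ , _ , refl | inj₁ S∈pairs with () ← proj₂ (proj₂ (∈-map⁻ pair∷ S∈pairs))
  ... | _ , _ , refl | inj₂ S∈wraps with () ← proj₂ (proj₂ (∈-map⁻ wrap S∈wraps))

length-cycleSets : ∀ r k →
  + (length (cycleSets r k) + δ (3 + r) k) ≡ (u (4 + r) ⊕ (z· u (2 + r))) k
length-cycleSets r zero = begin
  + (length (map (false ∷_) gaps ++ []) + 0) ≡⟨ cong +_ length-identity ⟩
  + length gaps                              ≡⟨ length-tilings (2 + r) zero ⟩
  u (3 + r) zero                             ≡⟨ trans (Int.+-identityʳ _) (Int.+-identityʳ _) ⟨
  (u (4 + r) ⊕ (z· u (2 + r))) zero          ∎
  where
  open ≡-Reasoning
  gaps = tilings (2 + r) zero
  length-identity : length (map (false ∷_) gaps ++ []) + 0 ≡ length gaps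
  length-identity = trans (+-identityʳ _)
    (trans (cong length (++-identityʳ (map (false ∷_) gaps))) (length-map (false ∷_) gaps))
length-cycleSets r (suc k) = begin
  + (length (cycleSets r (suc k)) + d)
    ≡⟨ cong +_ length-identity ⟩
  + (length gaps + length pairs + length pairs)
    ≡⟨ Int.pos-+ (length gaps + length pairs) _ ⟩
  + (length gaps + length pairs) +ℤ + length pairs
    ≡⟨ cong (_+ℤ + length pairs) (Int.pos-+ (length gaps) _) ⟩
  + length gaps +ℤ + length pairs +ℤ + length pairs
    ≡⟨ cong₂ _+ℤ_ (cong₂ _+ℤ_ (length-tilings (2 + r) (suc k)) (length-tilings (1 + r) k))
                  (length-tilings (1 + r) k) ⟩
  (u (4 + r) ⊕ (z· u (2 + r))) (suc k) ∎
  where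
  open ≡-Reasoning
  gaps = tilings (2 + r) (suc k)
  pairs = tilings (1 + r) k
  wraps = nonFullTilings (1 + r) k
  d = δ (1 + r) k
  length-identity : length (cycleSets r (suc k)) + d ≡ length gaps + length pairs + length pairs
  length-identity = begin
    length (map (false ∷_) gaps ++ map pair∷ pairs ++ map wrap wraps) + d
      ≡⟨ cong (_+ d) (length-++ (map (false ∷_) gaps)) ⟩
    length (map (false ∷_) gaps) + length (map pair∷ pairs ++ map wrap wraps) + d
      ≡⟨ cong (_+ d) (cong₂ _+_ (length-map _ gaps) (length-map++map _ _ pairs wraps)) ⟩
    length gaps + (length pairs + length wraps) + d
      ≡⟨ +-assoc (length gaps) _ _ ⟩
    length gaps + (length pairs + length wraps + d)
      ≡⟨ cong (λ n → length gaps + n) (+-assoc (length pairs) _ _) ⟩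
    length gaps + (length pairs + (length wraps + d))
      ≡⟨ cong (λ n → length gaps + (length pairs + n)) (length-nonFullTilings (1 + r) k) ⟨
    length gaps + (length pairs + length pairs)
      ≡⟨ +-assoc (length gaps) _ _ ⟨
    length gaps + length pairs + length pairs ∎

cycleSets⇔ : ∀ r k S → S ∈ₗ cycleSets r k ⇔ PMSetOfSize (Cycle (3 + r)) k S
cycleSets⇔ r k S = mk⇔
  (λ S∈ → let shape = ∈-cycleSets⁻ r k S∈ in cycleShape-size shape , cycleShape⇒pm shape)
  (λ (size , pm) → let j , shape = pm⇒cycleShape pm in
    ∈-cycleSets⁺ r (subst (CycleShape S) (size≡2*-injective {S = S} {k = k} (cycleShape-size shape) size) shape))

%2≡1⇒≢2* : ∀ n k → n % 2 ≡ 1 → n ≢ 2 * k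
%2≡1⇒≢2* _ k odd refl with () ← trans (sym (trans (cong (_% 2) (*-comm 2 k)) (m*n%n≡0 k 2))) odd

%2≡0⇒≡2*/2 : ∀ n → n % 2 ≡ 0 → n ≡ 2 * (n / 2)
%2≡0⇒≡2*/2 n even = begin
  n                 ≡⟨ m≡m%n+[m/n]*n n 2 ⟩
  n % 2 + n / 2 * 2 ≡⟨ cong (λ x → x + n / 2 * 2) even ⟩
  n / 2 * 2         ≡⟨ *-comm (n / 2) 2 ⟩
  2 * (n / 2)       ∎
  where open ≡-Reasoning

δ-odd : ∀ n k → n % 2 ≡ 1 → δ n k ≡ 0
δ-odd n k odd = δ-≢2* n k (%2≡1⇒≢2* n k odd)

δ-even : ∀ n k → n % 2 ≡ 0 → + δ n k ≡ zPow (n / 2) k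
δ-even n k even with k Nat.≟ n / 2
... | yes refl = cong +_ (subst (λ m → δ m (n / 2) ≡ 1) (sym (%2≡0⇒≡2*/2 n even)) (δ-2* (n / 2)))
... | no k≢n/2 = cong +_ (δ-≢2* n k λ n≡2k →
  k≢n/2 (*-cancelˡ-≡ k (n / 2) 2 (trans (sym n≡2k) (%2≡0⇒≡2*/2 n even))))

cycle-matchablePoly-odd : ∀ r → (3 + r) % 2 ≡ 1 →
  MatchablePolyIs (Cycle (3 + r)) (u (4 + r) ⊕ (z· u (2 + r)))
cycle-matchablePoly-odd r odd =
  matchablePoly-fromLists {G = Cycle (3 + r)} (cycleSets r) (cycleSets-unique r) (cycleSets⇔ r) count
  where
  count : ∀ k → + length (cycleSets r k) ≡ (u (4 + r) ⊕ (z· u (2 + r))) k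
  count k = begin
    + length (cycleSets r k)
      ≡⟨ cong +_ (+-identityʳ (length (cycleSets r k))) ⟨
    + (length (cycleSets r k) + 0)
      ≡⟨ cong (λ d → + (length (cycleSets r k) + d)) (δ-odd (3 + r) k odd) ⟨
    + (length (cycleSets r k) + δ (3 + r) k)
      ≡⟨ length-cycleSets r k ⟩
    (u (4 + r) ⊕ (z· u (2 + r))) k ∎
    where open ≡-Reasoning

cycle-matchablePoly-even : ∀ r → (3 + r) % 2 ≡ 0 →
  MatchablePolyIs (Cycle (3 + r)) ((u (4 + r) ⊕ (z· u (2 + r))) ⊖ zPow ((3 + r) / 2))
cycle-matchablePoly-even r even =
  matchablePoly-fromLists {G = Cycle (3 + r)} (cycleSets r) (cycleSets-unique r) (cycleSets⇔ r) count
  where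
  count : ∀ k → + length (cycleSets r k) ≡ ((u (4 + r) ⊕ (z· u (2 + r))) ⊖ zPow ((3 + r) / 2)) k
  count k = begin
    + length (cycleSets r k)
      ≡⟨ //-rightDividesʳ (+ δ (3 + r) k) _ ⟨
    + length (cycleSets r k) +ℤ + δ (3 + r) k - + δ (3 + r) k
      ≡⟨ cong (_- + δ (3 + r) k) (Int.pos-+ (length (cycleSets r k)) _) ⟨
    + (length (cycleSets r k) + δ (3 + r) k) - + δ (3 + r) k
      ≡⟨ cong₂ _-_ (length-cycleSets r k) (δ-even (3 + r) k even) ⟩
    ((u (4 + r) ⊕ (z· u (2 + r))) ⊖ zPow ((3 + r) / 2)) k ∎
    where open ≡-Reasoning

mainTheorem3 : ((n : ℕ) → 1 ≤ n → MatchablePolyIs (Path n) (u (suc n)))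
    × ((n : ℕ) → 3 ≤ n →
        (n % 2 ≡ 1 → MatchablePolyIs (Cycle n) (u (suc n) ⊕ (z· u (n ∸ 1))))
        × (n % 2 ≡ 0 → MatchablePolyIs (Cycle n) ((u (suc n) ⊕ (z· u (n ∸ 1))) ⊖ zPow (n / 2))))
-- The path formula holds for n = 0 as well.
mainTheorem3 = (λ n _ → path-matchablePoly n) , cycle
  where
  cycle : (n : ℕ) → 3 ≤ n →
    (n % 2 ≡ 1 → MatchablePolyIs (Cycle n) (u (suc n) ⊕ (z· u (n ∸ 1))))
    × (n % 2 ≡ 0 → MatchablePolyIs (Cycle n) ((u (suc n) ⊕ (z· u (n ∸ 1))) ⊖ zPow (n / 2)))
  cycle (suc (suc (suc r))) _                 = cycle-matchablePoly-odd r , cycle-matchablePoly-even r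
  cycle (suc zero)          (s≤s ())
  cycle (suc (suc zero))    (s≤s (s≤s ()))
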